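{- Let $R$ be a rule and let $r_1,\dots,r_n\in R$. Then $r_1^{+1}\cup r_2^{+2}\cup\dots\cup r_n^{+n}\in R$.
   Context: $2^{<\omega}$ finite binary strings. For finite $r\subseteq 2^{<\omega}\times\mathbb{Z}$ and $i\in\mathbb{Z}$, $r^{+i}=\{(\sigma,d+i):(\sigma,d)\in r\}$; for finite $r,s$, $s\prec r$ means that for every $(\sigma,d)\in s$ there is $d'\le d$ with $(\sigma,d')\in r$. A rule is a recursive set $R$ of finite subsets of $2^{<\omega}\times\mathbb{Z}$ such that $\emptyset\in R$; $r\in R$ and $s\prec r$ imply $s\in R$; $r,s\in R$ imply $(r\cup s)^{+1}\in R$. -}

module Defs where

open import Data.Bool using (Bool)
open import Data.List using (List; []; _∷_; _++_; map)
open import Data.List.Membership.Propositional using (_∈_)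
open import Data.List.Relation.Unary.All using (All)
open import Data.Nat using (ℕ; suc)
open import Data.Integer using (ℤ; +_; _+_; _≤_)
open import Data.Product using (_×_; _,_; ∃-syntax)
open import Relation.Nullary using (Dec)

Str : Set
Str = List Bool

Elem : Set
Elem = Str × ℤ

-- finite subsets of 2^{<ω} × ℤ, represented by lists (as sets: order and
-- repetitions irrelevant; every notion below only uses membership)
FinSet : Set
FinSet = List Elem

shift : ℤ → FinSet → FinSet
shift i r = map (λ { (σ , d) → (σ , d + i) }) r

_≺_ : FinSet → FinSet → Set
s ≺ r = ∀ {σ d} → (σ , d) ∈ s → ∃[ d' ] (d' ≤ d × (σ , d') ∈ r)

record Rule : Set₁ where
  field
    R        : FinSet → Set
    decide   : ∀ r → Dec (R r)
    empty    : R []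
    downward : ∀ {r s} → R r → s ≺ r → R s
    join     : ∀ {r s} → R r → R s → R (shift (+ 1) (r ++ s))

unionShift : ℕ → List FinSet → FinSet
unionShift k []       = []
unionShift k (r ∷ rs) = shift (+ k) r ++ unionShift (suc k) rs

-- Shifting by i and then by 1 is shifting by i + 1, so the union
-- r₁^{+1} ∪ r₂^{+2} ∪ … ∪ rₙ^{+n} equals (r₁ ∪ r₂^{+1} ∪ … ∪ rₙ^{+(n-1)})^{+1},
-- which lies in R by the join axiom once r₂^{+1} ∪ … ∪ rₙ^{+(n-1)} does;
-- induction on n.
module Submission where

open import Defs
open import Data.List using (List; []; _∷_; _++_)
open import Data.List.Properties using (map-++; map-∘; map-cong)
open import Data.List.Relation.Unary.All using (All; []; _∷_)
open import Data.Nat using (suc)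
open import Data.Integer using (+_; _+_)
open import Data.Integer.Properties using (+-assoc; +-comm)
open import Data.Product using (_,_)
open import Relation.Binary.PropositionalEquality
  using (_≡_; refl; sym; trans; cong; cong₂; subst; module ≡-Reasoning)

shift-++ : ∀ i r s → shift i (r ++ s) ≡ shift i r ++ shift i s
shift-++ i r s = map-++ _ r s

shift-shift : ∀ i j r → shift j (shift i r) ≡ shift (i + j) r
shift-shift i j r =
  trans (sym (map-∘ r)) (map-cong (λ { (σ , d) → cong (σ ,_) (+-assoc d i j) }) r)

unionShift-suc : ∀ k rs → unionShift (suc k) rs ≡ shift (+ 1) (unionShift k rs)
unionShift-suc k []       = refl
unionShift-suc k (r ∷ rs) = begin
  shift (+ suc k) r ++ unionShift (suc (suc k)) rs
    ≡⟨ cong (λ i → shift i r ++ unionShift (suc (suc k)) rs) (+-comm (+ 1) (+ k)) ⟩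
  shift (+ k + + 1) r ++ unionShift (suc (suc k)) rs
    ≡⟨ cong₂ _++_ (sym (shift-shift (+ k) (+ 1) r)) (unionShift-suc (suc k) rs) ⟩
  shift (+ 1) (shift (+ k) r) ++ shift (+ 1) (unionShift (suc k) rs)
    ≡⟨ sym (shift-++ (+ 1) (shift (+ k) r) (unionShift (suc k) rs)) ⟩
  shift (+ 1) (unionShift k (r ∷ rs))
    ∎
  where open ≡-Reasoning

unionShift-cons : ∀ r rs → unionShift 1 (r ∷ rs) ≡ shift (+ 1) (r ++ unionShift 1 rs)
unionShift-cons r rs = begin
  shift (+ 1) r ++ unionShift 2 rs               ≡⟨ cong (shift (+ 1) r ++_) (unionShift-suc 1 rs) ⟩
  shift (+ 1) r ++ shift (+ 1) (unionShift 1 rs) ≡⟨ sym (shift-++ (+ 1) r (unionShift 1 rs)) ⟩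
  shift (+ 1) (r ++ unionShift 1 rs)             ∎
  where open ≡-Reasoning

mainTheorem6 : (ℛ : Rule) (rs : List FinSet) →
    All (Rule.R ℛ) rs → Rule.R ℛ (unionShift 1 rs)
mainTheorem6 ℛ []       []       = Rule.empty ℛ
mainTheorem6 ℛ (r ∷ rs) (p ∷ ps) =
  subst (Rule.R ℛ) (sym (unionShift-cons r rs)) (Rule.join ℛ p (mainTheorem6 ℛ rs ps))
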